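{- Let $\mathcal B\subseteq\mathcal P([n])$ be a simply rooted family, and let $B\in\mathcal B$ be such that $B\setminus\{b\}\notin\mathcal B$ for some $b\in B$. Then $d_{\mathcal B}(B)\in\{B,B\setminus\{b\}\}$.
   Context: $\mathcal B$ is simply rooted if for every nonempty $B\in\mathcal B$ there is $b\in B$ with $\{C:\{b\}\subseteq C\subseteq B\}\subseteq\mathcal B$. For $\mathcal F\subseteq\mathcal P([n])$ and $i\in[n]$: $d_{(i,\mathcal F)}(F)=F\setminus\{i\}$ if $i\in F$ and $F\setminus\{i\}\notin\mathcal F$, else $F$; $d_i(\mathcal F)=\{d_{(i,\mathcal F)}(F):F\in\mathcal F\}$. With $\mathcal B_0=\mathcal B$, $\mathcal B_k=d_k(\mathcal B_{k-1})$, define for $B\in\mathcal B$: $d_{\mathcal B}(B)=d_{(n,\mathcal B_{n-1})}\circ\cdots\circ d_{(1,\mathcal B_0)}(B)$. -}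

module Defs where

open import Data.Nat using (ℕ; zero; suc)
open import Data.Bool using (Bool; true; false; _∧_; not; if_then_else_)
import Data.Bool as Bool
open import Data.Fin using (Fin)
open import Data.Fin.Subset using (Subset; _∈_; _⊆_; ⁅_⁆; _-_; Nonempty; inside; outside)
open import Data.Fin.Subset.Properties using (_∈?_)
open import Data.Vec using (Vec; []; _∷_)
open import Data.Vec.Properties using (≡-dec)
open import Data.List using (List; []; _∷_; map; _++_; allFin)
open import Data.Bool.ListAction using (any)
open import Data.Product using (∃; _×_)
open import Relation.Nullary.Decidable using (Dec; ⌊_⌋)
open import Relation.Binary.PropositionalEquality using (_≡_)

Family : ℕ → Set
Family n = Subset n → Bool

allSubsets : (n : ℕ) → List (Subset n)
allSubsets zero    = [] ∷ []
allSubsets (suc n) = map (outside ∷_) (allSubsets n) ++ map (inside ∷_) (allSubsets n)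

_≟ₛ_ : {n : ℕ} → (p q : Subset n) → Dec (p ≡ q)
_≟ₛ_ = ≡-dec Bool._≟_

SimplyRooted : {n : ℕ} → Family n → Set
SimplyRooted {n} ℬ =
  (B : Subset n) → ℬ B ≡ true → Nonempty B →
  ∃ λ (b : Fin n) → b ∈ B ×
    ((C : Subset n) → ⁅ b ⁆ ⊆ C → C ⊆ B → ℬ C ≡ true)

dStep : {n : ℕ} → Fin n → Family n → Subset n → Subset n
dStep i ℱ F = if ⌊ i ∈? F ⌋ ∧ not (ℱ (F - i)) then F - i else F

dFam : {n : ℕ} → Fin n → Family n → Family n
dFam {n} i ℱ G = any (λ F → ℱ F ∧ ⌊ dStep i ℱ F ≟ₛ G ⌋) (allSubsets n)

dSeq : {n : ℕ} → List (Fin n) → Family n → Subset n → Subset n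
dSeq []       ℬ B = B
dSeq (i ∷ is) ℬ B = dSeq is (dFam i ℬ) (dStep i ℬ B)

-- d_ℬ(B) = d_(n, ℬ_{n-1}) ∘ ⋯ ∘ d_(1, ℬ_0) (B); coordinate k ∈ [n] is Fin index k-1.
dB : {n : ℕ} → Family n → Subset n → Subset n
dB {n} ℬ B = dSeq (allFin n) ℬ B

module Submission where

-- Since B∖b ∉ ℬ, the root of B must be b, so the whole
-- interval [{b}, B] lies in ℬ; and for every G ∈ ℬ with B∖b ⊆ G and b ∉ G no
-- root of G lies in B∖b, so the interval [G ─ B∖b, G] lies in ℬ as well.
--
-- Consequently a set whose whole down-set lies in ℱ is fixed by every later
-- compression.  The two interval facts above survive every compression d_i
-- with i ≠ b and keep B fixed.  At the coordinate b, either B∖b is still a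
-- member (then the down-set of B lies in the family and B stays forever) or B
-- drops to B∖b, whose down-set is the image of [{b}, B] and so lies in the
-- compressed family; either way the final value is B or B∖b.

open import Defs
open import Data.Nat using (ℕ; suc)
open import Data.Bool using (true; false)
open import Data.Bool.Properties using (T-≡; T-∧)
open import Data.Fin using (Fin; _≟_)
open import Data.Fin.Subset
  using (Subset; _∈_; _∉_; _⊆_; _-_; _─_; _∪_; ⁅_⁆; ⊥; inside; outside)
open import Data.Fin.Subset.Properties
  using ( _∈?_; nonempty?; ∉⊥; ⊥⊆; ⊆-refl; ⊆-antisym
        ; x∈⁅x⁆; x∈⁅y⁆⇒x≡y; x∈p∪q⁺; x∈p∪q⁻
        ; p─q⊆p; x∈p∧x∉q⇒x∈p─q; x∈p∧x≢y⇒x∈p-y; p─q─r≡p─r─q)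
open import Data.Vec using ([]; _∷_; here; there)
open import Data.List using (List; []; _∷_; map; allFin)
open import Data.List.Membership.Propositional using (lose) renaming (_∈_ to _∈ₗ_)
open import Data.List.Membership.Propositional.Properties using (∈-map⁺; ∈-++⁺ˡ; ∈-++⁺ʳ)
open import Data.List.Relation.Unary.Any using (satisfied) renaming (here to hereₗ)
open import Data.List.Relation.Unary.Any.Properties using (any⁺; any⁻)
open import Data.Product using (∃; _×_; _,_)
open import Data.Sum using (_⊎_; inj₁; inj₂)
open import Function.Bundles using (Equivalence)
open import Relation.Nullary using (yes; no; contradiction)
open import Relation.Nullary.Decidable using (fromWitness; toWitness)
open import Relation.Binary.PropositionalEquality
  using (_≡_; _≢_; ≢-sym; refl; sym; trans; subst; cong)

private
  variable
    n : ℕ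
    i x y : Fin n
    p q : Subset n
    ℱ : Family n

∈─⇒∉ : x ∈ p ─ q → x ∉ q
∈─⇒∉ {p = _ ∷ _} {q = inside ∷ _} () here
∈─⇒∉ {p = _ ∷ _} {q = _ ∷ _} (there x∈p─q) (there x∈q) = ∈─⇒∉ x∈p─q x∈q

p-x⊆p : p - x ⊆ p
p-x⊆p {p = p} {x = x} = p─q⊆p p ⁅ x ⁆

x∈p-y⇒x≢y : x ∈ p - y → x ≢ y
x∈p-y⇒x≢y {y = y} x∈p-y refl = ∈─⇒∉ x∈p-y (x∈⁅x⁆ y)

p─p⊆⊥ : p ─ p ⊆ ⊥
p─p⊆⊥ {p = p} x∈p─p = contradiction (p─q⊆p p p x∈p─p) (∈─⇒∉ x∈p─p)

-‿mono : p ⊆ q → p - x ⊆ q - x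
-‿mono p⊆q y∈p-x = x∈p∧x≢y⇒x∈p-y (p⊆q (p-x⊆p y∈p-x)) (x∈p-y⇒x≢y y∈p-x)

x∈p⇒⁅x⁆⊆p : x ∈ p → ⁅ x ⁆ ⊆ p
x∈p⇒⁅x⁆⊆p {x = x} x∈p y∈⁅x⁆ = subst (_∈ _) (sym (x∈⁅y⁆⇒x≡y x y∈⁅x⁆)) x∈p

⊆-minus : q ⊆ p → i ∉ q → q ⊆ p - i
⊆-minus q⊆p i∉q x∈q = x∈p∧x≢y⇒x∈p-y (q⊆p x∈q) (λ { refl → i∉q x∈q })

∪⁅x⁆-x : x ∉ p → (p ∪ ⁅ x ⁆) - x ≡ p
∪⁅x⁆-x {x = x} {p = p} x∉p = ⊆-antisym shrink (⊆-minus (λ y∈p → x∈p∪q⁺ (inj₁ y∈p)) x∉p)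
  where
  shrink : (p ∪ ⁅ x ⁆) - x ⊆ p
  shrink y∈ with x∈p∪q⁻ p ⁅ x ⁆ (p-x⊆p y∈)
  ... | inj₁ y∈p = y∈p
  ... | inj₂ y∈⁅x⁆ = contradiction (x∈⁅y⁆⇒x≡y x y∈⁅x⁆) (x∈p-y⇒x≢y y∈)

allSubsets-complete : (p : Subset n) → p ∈ₗ allSubsets n
allSubsets-complete [] = hereₗ refl
allSubsets-complete {suc n} (outside ∷ p) =
  ∈-++⁺ˡ (∈-map⁺ (outside ∷_) (allSubsets-complete p))
allSubsets-complete {suc n} (inside ∷ p) =
  ∈-++⁺ʳ (map (outside ∷_) (allSubsets n)) (∈-map⁺ (inside ∷_) (allSubsets-complete p))

data Compression (i : Fin n) (ℱ : Family n) (F : Subset n) : Subset n → Set where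
  kept    : (i ∈ F → ℱ (F - i) ≡ true) → Compression i ℱ F F
  removed : i ∈ F → ℱ (F - i) ≡ false → Compression i ℱ F (F - i)

compression : (i : Fin n) (ℱ : Family n) (F : Subset n) → Compression i ℱ F (dStep i ℱ F)
compression i ℱ F with i ∈? F | ℱ (F - i) in eq
... | yes i∈F | true  = kept (λ _ → eq)
... | yes i∈F | false = removed i∈F eq
... | no  i∉F | _     = kept (λ i∈F → contradiction i∈F i∉F)

fixed-by : (i : Fin n) (ℱ : Family n) (F : Subset n) →
  (i ∈ F → ℱ (F - i) ≡ true) → dStep i ℱ F ≡ F
fixed-by i ℱ F F-i∈ℱ with dStep i ℱ F | compression i ℱ F
... | _ | kept _              = refl
... | _ | removed i∈F F-i∉ℱ = contradiction (trans (sym (F-i∈ℱ i∈F)) F-i∉ℱ) λ ()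

dFam-intro : (i : Fin n) (ℱ : Family n) (F : Subset n) →
  ℱ F ≡ true → dFam i ℱ (dStep i ℱ F) ≡ true
dFam-intro i ℱ F F∈ℱ = Equivalence.to T-≡ (any⁺ _ (lose (allSubsets-complete F) image))
  where
  image = Equivalence.from T-∧ (Equivalence.from T-≡ F∈ℱ , fromWitness refl)

dFam-elim : (i : Fin n) (ℱ : Family n) (G : Subset n) →
  dFam i ℱ G ≡ true → ∃ λ F → ℱ F ≡ true × dStep i ℱ F ≡ G
dFam-elim {n} i ℱ G G∈ with satisfied (any⁻ _ (allSubsets n) (Equivalence.from T-≡ G∈))
... | F , image with Equivalence.to T-∧ image
...   | F∈ℱ , F↦G = F , Equivalence.to T-≡ F∈ℱ , toWitness F↦G

dFam-cases : (i : Fin n) (ℱ : Family n) (G : Subset n) → dFam i ℱ G ≡ true →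
  (ℱ G ≡ true × (i ∈ G → ℱ (G - i) ≡ true)) ⊎
  (∃ λ F → ℱ F ≡ true × i ∈ F × G ≡ F - i)
dFam-cases i ℱ G G∈ with dFam-elim i ℱ G G∈
... | F , F∈ℱ , F↦G with dStep i ℱ F | compression i ℱ F | F↦G
...   | _ | kept F-i∈ℱ    | refl = inj₁ (F∈ℱ , F-i∈ℱ)
...   | _ | removed i∈F _ | refl = inj₂ (F , F∈ℱ , i∈F , refl)

kept-member : (i : Fin n) (ℱ : Family n) (F : Subset n) →
  ℱ F ≡ true → (i ∈ F → ℱ (F - i) ≡ true) → dFam i ℱ F ≡ true
kept-member i ℱ F F∈ℱ F-i∈ℱ =
  subst (λ G → dFam i ℱ G ≡ true) (fixed-by i ℱ F F-i∈ℱ) (dFam-intro i ℱ F F∈ℱ)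

-- If F ∈ ℱ contains i, then F - i ∈ d_i(ℱ): it is either kept or the image of F.
removed-member : (i : Fin n) (ℱ : Family n) (F : Subset n) →
  ℱ F ≡ true → i ∈ F → dFam i ℱ (F - i) ≡ true
removed-member i ℱ F F∈ℱ i∈F with dStep i ℱ F | compression i ℱ F | dFam-intro i ℱ F F∈ℱ
... | _ | kept F-i∈ℱ  | _    =
  kept-member i ℱ (F - i) (F-i∈ℱ i∈F) (λ i∈F-i → contradiction refl (x∈p-y⇒x≢y i∈F-i))
... | _ | removed _ _ | F-i∈ = F-i∈

-- Intervals of a family: every C with L ⊆ C ⊆ U is a member of ℱ.
-- (b is a root of B in the sense of SimplyRooted exactly when Interval ℬ ⁅ b ⁆ B.)
Interval : Family n → Subset n → Subset n → Set
Interval {n} ℱ L U = (C : Subset n) → L ⊆ C → C ⊆ U → ℱ C ≡ true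

module _ {L U : Subset n} where

  interval-⊆ : {L′ U′ : Subset n} → Interval ℱ L U → L ⊆ L′ → U′ ⊆ U → Interval ℱ L′ U′
  interval-⊆ I L⊆L′ U′⊆U C L′⊆C C⊆U′ = I C (λ x∈L → L′⊆C (L⊆L′ x∈L)) (λ x∈C → U′⊆U (C⊆U′ x∈C))

  interval-keep : Interval ℱ L U → Interval ℱ (L - i) (U - i) → Interval (dFam i ℱ) L U
  interval-keep {ℱ = ℱ} {i = i} I I-i C L⊆C C⊆U = kept-member i ℱ C (I C L⊆C C⊆U)
    (λ _ → I-i (C - i) (-‿mono L⊆C) (-‿mono C⊆U))

  interval-keep-away : i ∉ L → Interval ℱ L U → Interval (dFam i ℱ) L U
  interval-keep-away i∉L I = interval-keep I (interval-⊆ I (⊆-minus ⊆-refl i∉L) p-x⊆p)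

  -- d_i pushes an interval whose top contains i down by i: C ⊆ U - i is the
  -- image of C ∪ {i} ∈ [L, U].
  interval-lower : i ∈ U → Interval ℱ L U → Interval (dFam i ℱ) (L - i) (U - i)
  interval-lower {i = i} {ℱ = ℱ} i∈U I C L-i⊆C C⊆U-i =
    subst (λ D → dFam i ℱ D ≡ true) (∪⁅x⁆-x i∉C)
          (removed-member i ℱ (C ∪ ⁅ i ⁆) (I (C ∪ ⁅ i ⁆) L⊆C∪i C∪i⊆U)
                          (x∈p∪q⁺ (inj₂ (x∈⁅x⁆ i))))
    where
    i∉C : i ∉ C
    i∉C i∈C = x∈p-y⇒x≢y (C⊆U-i i∈C) refl

    L⊆C∪i : L ⊆ C ∪ ⁅ i ⁆
    L⊆C∪i {x} x∈L with x ≟ i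
    ... | yes refl = x∈p∪q⁺ (inj₂ (x∈⁅x⁆ i))
    ... | no x≢i   = x∈p∪q⁺ (inj₁ (L-i⊆C (x∈p∧x≢y⇒x∈p-y x∈L x≢i)))

    C∪i⊆U : C ∪ ⁅ i ⁆ ⊆ U
    C∪i⊆U x∈C∪i with x∈p∪q⁻ C ⁅ i ⁆ x∈C∪i
    ... | inj₁ x∈C = p-x⊆p (C⊆U-i x∈C)
    ... | inj₂ x∈i = subst (_∈ U) (sym (x∈⁅y⁆⇒x≡y i x∈i)) i∈U

down-split : {U : Subset n} (b : Fin n) →
  Interval ℱ ⁅ b ⁆ U → Interval ℱ ⊥ (U - b) → Interval ℱ ⊥ U
down-split b above below C _ C⊆U with b ∈? C
... | yes b∈C = above C (x∈p⇒⁅x⁆⊆p b∈C) C⊆U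
... | no  b∉C = below C ⊥⊆ (⊆-minus C⊆U b∉C)

down-closed-fixed : (is : List (Fin n)) {A : Subset n} → Interval ℱ ⊥ A → dSeq is ℱ A ≡ A
down-closed-fixed []       _    = refl
down-closed-fixed {ℱ = ℱ} (i ∷ is) {A} down =
  trans (cong (dSeq is (dFam i ℱ)) (fixed-by i ℱ A (λ _ → down (A - i) ⊥⊆ p-x⊆p)))
        (down-closed-fixed is (interval-keep-away ∉⊥ down))

root-avoids : {r : Fin n} {U A : Subset n} → Interval ℱ ⁅ r ⁆ U → ℱ A ≡ false → A ⊆ U → r ∉ A
root-avoids root A∉ℱ A⊆U r∈A =
  contradiction (trans (sym (root _ (x∈p⇒⁅x⁆⊆p r∈A) A⊆U)) A∉ℱ) λ ()

module Hypotheses {ℬ : Family n} (rooted : SimplyRooted ℬ) {B : Subset n} (B∈ℬ : ℬ B ≡ true)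
         {b : Fin n} (b∈B : b ∈ B) (B∖b∉ℬ : ℬ (B - b) ≡ false) where

  B∖b : Subset n
  B∖b = B - b

  RootInterval : Family n → Set
  RootInterval ℱ = Interval ℱ ⁅ b ⁆ B

  AboveInterval : Family n → Set
  AboveInterval ℱ = (G : Subset n) → ℱ G ≡ true → B∖b ⊆ G → b ∉ G → Interval ℱ (G ─ B∖b) G

  -- The root of B is b, since any other root would put B∖b into ℬ.
  root-interval : RootInterval ℬ
  root-interval with rooted B B∈ℬ (b , b∈B)
  ... | r , r∈B , root with r ≟ b
  ...   | yes refl = root
  ...   | no  r≢b  = contradiction (x∈p∧x≢y⇒x∈p-y r∈B r≢b) (root-avoids root B∖b∉ℬ p-x⊆p)

  -- A member G ⊇ B∖b differs from B∖b, so it is nonempty, and its root lies in G ─ B∖b.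
  above-interval : AboveInterval ℬ
  above-interval G G∈ℬ B∖b⊆G b∉G with nonempty? G
  ... | no empty =
    contradiction (trans (sym G∈ℬ) (subst (λ D → ℬ D ≡ false) B∖b≡G B∖b∉ℬ)) λ ()
    where
    B∖b≡G : B∖b ≡ G
    B∖b≡G = ⊆-antisym B∖b⊆G (λ {x} x∈G → contradiction (x , x∈G) empty)
  ... | yes nonempty with rooted G G∈ℬ nonempty
  ...   | r , r∈G , root = interval-⊆ root
          (x∈p⇒⁅x⁆⊆p (x∈p∧x∉q⇒x∈p─q r∈G (root-avoids root B∖b∉ℬ B∖b⊆G))) ⊆-refl

  above-step : {ℱ : Family n} (i : Fin n) → i ≢ b → AboveInterval ℱ → AboveInterval (dFam i ℱ)
  above-step {ℱ} i i≢b above G G∈ B∖b⊆G b∉G with dFam-cases i ℱ G G∈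
  ... | inj₁ (G∈ℱ , G-i∈ℱ) with i ∈? (G ─ B∖b)
  ...   | no  i∉G─B∖b = interval-keep-away i∉G─B∖b (above G G∈ℱ B∖b⊆G b∉G)
  ...   | yes i∈G─B∖b = interval-keep (above G G∈ℱ B∖b⊆G b∉G)
          (subst (λ L → Interval ℱ L (G - i)) (sym (p─q─r≡p─r─q G B∖b ⁅ i ⁆))
            (above (G - i) (G-i∈ℱ (p─q⊆p G B∖b i∈G─B∖b))
                   (⊆-minus B∖b⊆G (∈─⇒∉ i∈G─B∖b)) (λ b∈G-i → b∉G (p-x⊆p b∈G-i))))
  above-step {ℱ} i i≢b above G G∈ B∖b⊆G b∉G | inj₂ (F , F∈ℱ , i∈F , refl) =
    subst (λ L → Interval (dFam i ℱ) L (F - i)) (p─q─r≡p─r─q F B∖b ⁅ i ⁆)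
      (interval-lower i∈F (above F F∈ℱ (λ x∈B∖b → p-x⊆p (B∖b⊆G x∈B∖b))
                                       (λ b∈F → b∉G (x∈p∧x≢y⇒x∈p-y b∈F (≢-sym i≢b)))))

  final-value : (is : List (Fin n)) (ℱ : Family n) → RootInterval ℱ → AboveInterval ℱ →
    dSeq is ℱ B ≡ B ⊎ dSeq is ℱ B ≡ B∖b
  final-value [] ℱ _ _ = inj₁ refl
  final-value (i ∷ is) ℱ root above with i ≟ b
  ... | no i≢b = subst (λ D → dSeq is (dFam i ℱ) D ≡ B ⊎ dSeq is (dFam i ℱ) D ≡ B∖b)
          (sym (fixed-by i ℱ B (λ _ → root (B - i) ⁅b⁆⊆B-i p-x⊆p)))
          (final-value is (dFam i ℱ) (interval-keep-away i∉⁅b⁆ root) (above-step i i≢b above))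
    where
    ⁅b⁆⊆B-i : ⁅ b ⁆ ⊆ B - i
    ⁅b⁆⊆B-i = x∈p⇒⁅x⁆⊆p (x∈p∧x≢y⇒x∈p-y b∈B (≢-sym i≢b))

    i∉⁅b⁆ : i ∉ ⁅ b ⁆
    i∉⁅b⁆ i∈⁅b⁆ = i≢b (x∈⁅y⁆⇒x≡y b i∈⁅b⁆)
  ... | yes refl with dStep b ℱ B | compression b ℱ B
  ...   | _ | kept B∖b∈ℱ = inj₁ (down-closed-fixed is (interval-keep-away ∉⊥ down-B))
    where
    b∉B∖b : b ∉ B∖b
    b∉B∖b b∈B∖b = x∈p-y⇒x≢y b∈B∖b refl

    -- B∖b ∈ ℱ puts its whole down-set into ℱ, so together with [{b}, B]
    -- the whole down-set of B lies in ℱ.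
    down-B : Interval ℱ ⊥ B
    down-B = down-split b root
      (interval-⊆ (above B∖b (B∖b∈ℱ b∈B) ⊆-refl b∉B∖b) p─p⊆⊥ ⊆-refl)
  ...   | _ | removed _ _ =
    inj₂ (down-closed-fixed is (interval-⊆ (interval-lower b∈B root) p─p⊆⊥ ⊆-refl))

lemma14 : (n : ℕ) (ℬ : Family n) → SimplyRooted ℬ →
    (B : Subset n) → ℬ B ≡ true →
    (b : Fin n) → b ∈ B → ℬ (B - b) ≡ false →
    dB ℬ B ≡ B ⊎ dB ℬ B ≡ B - b
lemma14 n ℬ rooted B B∈ℬ b b∈B B∖b∉ℬ =
  final-value (allFin n) ℬ root-interval above-interval
  where open Hypotheses rooted B∈ℬ b∈B B∖b∉ℬ
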